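{- Let $G$ be a graph with no isolated vertex that is not a disjoint union of copies of $K_2$, and let $H$ be any nontrivial graph with root $v\in V(H)$. The following statements are equivalent: (i) $\gamma_R(G\circ_v H)=\gamma_R(G)+n(G)(\gamma_R(H)-1)$; (ii) $\gamma_R(H-v)=\gamma_R(H)-1$ and $g(v)\leq 1$ for every Roman dominating function $g$ on $H$ of weight $\gamma_R(H)$.
   Context: All graphs are finite and simple; a graph is nontrivial if it has at least two vertices; $n(G)=|V(G)|$; $K_2$ is the graph with one edge. For a graph $G$ and a nontrivial graph $H$ with a root $v\in V(H)$, the rooted product graph $G\circ_v H$ is obtained by taking one copy of $G$ and $n(G)$ copies of $H$, and identifying the $i$-th vertex of $G$ with the vertex $v$ in the $i$-th copy of $H$, for each $i$. $H-v$ is $H$ with $v$ deleted. A Roman dominating function on a graph $X$ is $f:V(X)\to\{0,1,2\}$ such that every vertex with value $0$ has a neighbor with value $2$; its weight is $\sum_u f(u)$, and $\gamma_R(X)$ is the minimum weight of such $f$. -}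

module Defs where

open import Data.Nat using (ℕ; zero; suc; _+_; _*_; _≤_)
open import Data.Fin using (Fin; zero; suc; remQuot; punchIn; _≟_)
open import Data.Bool using (Bool; true; false; _∧_; _∨_)
open import Data.Product using (Σ; ∃; _×_; _,_; proj₁; proj₂)
open import Relation.Binary.PropositionalEquality using (_≡_)
open import Relation.Nullary.Decidable using (⌊_⌋)
open import Relation.Nullary using (¬_)

record Graph (n : ℕ) : Set where
  field
    adj    : Fin n → Fin n → Bool
    sym    : ∀ i j → adj i j ≡ adj j i
    irrefl : ∀ i → adj i i ≡ false
open Graph public

Adj : ∀ {n} → Graph n → Fin n → Fin n → Set
Adj G i j = adj G i j ≡ true

nV : ∀ {n} → Graph n → ℕ
nV {n} _ = n

NoIsolated : ∀ {n} → Graph n → Set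
NoIsolated {n} G = ∀ (i : Fin n) → ∃ λ j → Adj G i j

IsDisjointUnionOfK2 : ∀ {n} → Graph n → Set
IsDisjointUnionOfK2 {n} G =
  ∀ (i : Fin n) → ∃ λ j → Adj G i j × (∀ k → Adj G i k → k ≡ j)

deleteVertex : ∀ {m} → Graph (suc m) → Fin (suc m) → Graph m
deleteVertex H v = record
  { adj    = λ x y → adj H (punchIn v x) (punchIn v y)
  ; sym    = λ x y → sym H (punchIn v x) (punchIn v y)
  ; irrefl = λ x → irrefl H (punchIn v x)
  }

-- Vertex (i , x) (encoded via remQuot) is vertex x of the
-- i-th copy of H; vertex (i , v) is identified with vertex i of G.
-- (i,x) ~ (j,y)  iff  (i = j and x ~_H y)  or  (x = y = v and i ~_G j).
rpAdj' : ∀ {n k} → Graph n → Graph k → Fin k → Fin n × Fin k → Fin n × Fin k → Bool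
rpAdj' G H v (i , x) (j , y) =
  (⌊ i ≟ j ⌋ ∧ adj H x y) ∨ (⌊ x ≟ v ⌋ ∧ ⌊ y ≟ v ⌋ ∧ adj G i j)

rpAdj : ∀ {n k} → Graph n → Graph k → Fin k → Fin (n * k) → Fin (n * k) → Bool
rpAdj {n} {k} G H v a b = rpAdj' G H v (remQuot {n} k a) (remQuot {n} k b)

open import Data.Bool.Properties using (∧-comm; ∨-comm)
open import Relation.Binary.PropositionalEquality using (refl; cong₂; cong)
import Data.Fin.Properties as FP
import Data.Nat.Properties as NP

open import Data.Empty using (⊥-elim)
open import Relation.Nullary using (yes; no)
import Relation.Binary.PropositionalEquality as Eq

private
  ⌊≟⌋-sym : ∀ {k} (i j : Fin k) → ⌊ i ≟ j ⌋ ≡ ⌊ j ≟ i ⌋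
  ⌊≟⌋-sym i j with i ≟ j | j ≟ i
  ... | yes _ | yes _ = refl
  ... | no _  | no _  = refl
  ... | yes p | no q  = ⊥-elim (q (Eq.sym p))
  ... | no p  | yes q = ⊥-elim (p (Eq.sym q))

  lem : ∀ p q r s → r ≡ s → p ∧ q ∧ r ≡ q ∧ p ∧ s
  lem false false r s e = refl
  lem false true  r s e = refl
  lem true  false r s e = refl
  lem true  true  r s e = e

rpSym : ∀ {n k} (G : Graph n) (H : Graph k) (v : Fin k) a b →
        rpAdj G H v a b ≡ rpAdj G H v b a
rpSym {n} {k} G H v a b = go (remQuot {n} k a) (remQuot {n} k b)
  where
  go : ∀ p q → rpAdj' G H v p q ≡ rpAdj' G H v q p
  go (i , x) (j , y) =
    cong₂ _∨_ (cong₂ _∧_ (⌊≟⌋-sym i j) (sym H x y))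
      (lem ⌊ x ≟ v ⌋ ⌊ y ≟ v ⌋ (adj G i j) (adj G j i) (sym G i j))

rpIrrefl : ∀ {n k} (G : Graph n) (H : Graph k) (v : Fin k) a → rpAdj G H v a a ≡ false
rpIrrefl {n} {k} G H v a = go (remQuot {n} k a)
  where
  go : ∀ p → rpAdj' G H v p p ≡ false
  go (i , x) rewrite irrefl H x | irrefl G i with i ≟ i | x ≟ v
  ... | yes _ | yes _ = refl
  ... | yes _ | no _  = refl
  ... | no _  | yes _ = refl
  ... | no _  | no _  = refl

rootedProduct : ∀ {n k} → Graph n → Graph k → Fin k → Graph (n * k)
rootedProduct G H v = record
  { adj = rpAdj G H v ; sym = rpSym G H v ; irrefl = rpIrrefl G H v }

weight : ∀ {n} → (Fin n → ℕ) → ℕ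
weight {zero}  f = 0
weight {suc n} f = f zero + weight (λ i → f (suc i))

IsRDF : ∀ {n} → Graph n → (Fin n → ℕ) → Set
IsRDF {n} G f =
  (∀ i → f i ≤ 2) × (∀ i → f i ≡ 0 → ∃ λ j → Adj G i j × f j ≡ 2)

IsRomanDomNum : ∀ {n} → Graph n → ℕ → Set
IsRomanDomNum {n} G k =
  (∃ λ (f : Fin n → ℕ) → IsRDF G f × weight f ≡ k) ×
  (∀ (f : Fin n → ℕ) → IsRDF G f → k ≤ weight f)

module Submission where

-- Write n = n(G) and a = γR(H) − 1.  An RDF of G ∘ᵥ H restricts to each copy of H either as
-- an RDF of H or, when the root gets 0 and is dominated only from a neighbouring copy, as an
-- RDF of H − v padded by 0 at v.  Gluing an optimal RDF of H − v with value f(i) on the root of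
-- copy i, for an optimal f on G, gives γR(G ∘ᵥ H) ≤ γR(G) + n·γR(H − v), and always
-- a ≤ γR(H − v).  If γR(H − v) = a and optimal RDFs of H put at most 1 on v, charging copy i
-- with 2, 1 or 0 (its root has value 2 / is otherwise dominated inside the copy / is dominated
-- only from outside) yields an RDF of G, whence the matching lower bound γR(G) + n·a.
-- Conversely, a vertex of G with two neighbours carries an RDF of weight n − 1, so γR(G) < n.
-- Then γR(G ∘ᵥ H) ≥ n·min(γR(H), γR(H − v)) forces γR(H − v) = a, and every optimal f on G has
-- a vertex of value 2, in whose copy an optimal g with g(v) = 2 would undercut γR(G) + n·a.

open import Data.Bool as Bool using (true; false)
open import Data.Bool.Properties using (∨-zeroʳ)
open import Data.Empty using (⊥-elim)
open import Data.Fin using (Fin; zero; suc; punchIn; punchOut; combine; remQuot; _↑ˡ_; _↑ʳ_)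
import Data.Fin.Properties as Fin
open import Data.Nat using (ℕ; zero; suc; _+_; _*_; _∸_; _≤_; _<_; z≤n; s≤s)
open import Data.Nat.Properties
open import Algebra.Properties.CommutativeSemigroup +-commutativeSemigroup using (interchange; x∙yz≈y∙xz)
open import Data.Product using (∃; _×_; _,_; proj₁; proj₂; uncurry)
open import Data.Sum using (_⊎_; inj₁; inj₂)
open import Data.Vec.Functional using (insertAt; removeAt)
open import Data.Vec.Functional.Properties using (insertAt-lookup; insertAt-punchIn)
open import Function using (_∘_)
open import Function.Bundles using (_⇔_; mk⇔)
open import Relation.Binary.PropositionalEquality
open import Relation.Nullary using (¬_; yes; no; Dec)
open import Relation.Nullary.Decidable using (_×-dec_; ¬?)

open import Defs hiding (sym)

weight-cong : ∀ {n} {f g : Fin n → ℕ} → (∀ i → f i ≡ g i) → weight f ≡ weight g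
weight-cong {zero}  f≗g = refl
weight-cong {suc n} f≗g = cong₂ _+_ (f≗g zero) (weight-cong (f≗g ∘ suc))

weight-mono : ∀ {n} {f g : Fin n → ℕ} → (∀ i → f i ≤ g i) → weight f ≤ weight g
weight-mono {zero}  f≤g = z≤n
weight-mono {suc n} f≤g = +-mono-≤ (f≤g zero) (weight-mono (f≤g ∘ suc))

weight-distrib-+ : ∀ {n} (f g : Fin n → ℕ) → weight (λ i → f i + g i) ≡ weight f + weight g
weight-distrib-+ {zero}  f g = refl
weight-distrib-+ {suc n} f g =
  trans (cong (f zero + g zero +_) (weight-distrib-+ (f ∘ suc) (g ∘ suc)))
        (interchange (f zero) (g zero) (weight (f ∘ suc)) (weight (g ∘ suc)))

weight-const : ∀ n c → weight {n} (λ _ → c) ≡ n * c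
weight-const zero    c = refl
weight-const (suc n) c = cong (c +_) (weight-const n c)

weight-+-const : ∀ {n} (f : Fin n → ℕ) c → weight (λ i → f i + c) ≡ weight f + n * c
weight-+-const {n} f c = trans (weight-distrib-+ f (λ _ → c)) (cong (weight f +_) (weight-const n c))

weight-removeAt : ∀ {n} (g : Fin (suc n) → ℕ) i → weight g ≡ g i + weight (removeAt g i)
weight-removeAt g zero = refl
weight-removeAt {suc n} g (suc i) =
  trans (cong (g zero +_) (weight-removeAt (g ∘ suc) i))
        (x∙yz≈y∙xz (g zero) (g (suc i)) (weight (removeAt (g ∘ suc) i)))

weight-mono-< : ∀ {n} {f g : Fin n → ℕ} → (∀ i → f i ≤ g i) → ∀ i → f i < g i → weight f < weight g
weight-mono-< {suc n} {f} {g} f≤g i fᵢ<gᵢ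
  rewrite weight-removeAt f i | weight-removeAt g i =
  +-mono-<-≤ fᵢ<gᵢ (weight-mono (f≤g ∘ punchIn i))

weight-++ : ∀ k {m} (f : Fin (k + m) → ℕ) →
            weight f ≡ weight (λ i → f (i ↑ˡ m)) + weight (λ j → f (k ↑ʳ j))
weight-++ zero    f = refl
weight-++ (suc k) f =
  trans (cong (f zero +_) (weight-++ k (f ∘ suc))) (sym (+-assoc (f zero) _ _))

weight-combine : ∀ {n} k (f : Fin (n * k) → ℕ) →
                 weight f ≡ weight {n} (λ i → weight {k} (λ x → f (combine i x)))
weight-combine {zero}  k f = refl
weight-combine {suc n} k f =
  trans (weight-++ k f) (cong (weight (λ x → f (x ↑ˡ (n * k))) +_) (weight-combine {n} k (f ∘ (k ↑ʳ_))))

point≤weight : ∀ {n} (g : Fin (suc n) → ℕ) i → g i ≤ weight g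
point≤weight g i = subst (g i ≤_) (sym (weight-removeAt g i)) (m≤m+n (g i) _)

rdf-weight-positive : ∀ {k} (X : Graph (suc k)) {g} → IsRDF X g → 1 ≤ weight g
rdf-weight-positive X {g} (_ , dominated) with g zero ≟ 0
... | no g₀≢0 = ≤-trans (n≢0⇒n>0 g₀≢0) (point≤weight g zero)
... | yes g₀≡0 with dominated zero g₀≡0
...   | j , _ , gⱼ≡2 = ≤-trans (s≤s z≤n) (subst (_≤ weight g) gⱼ≡2 (point≤weight g j))

data RootView {k} (v : Fin (suc k)) : Fin (suc k) → Set where
  root  : RootView v v
  other : ∀ x → RootView v (punchIn v x)

rootView : ∀ {k} (v x : Fin (suc k)) → RootView v x
rootView v x with v Fin.≟ x
... | yes refl = root
... | no v≢x   = subst (RootView v) (Fin.punchIn-punchOut v≢x) (other (punchOut v≢x))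

weight-insertAt : ∀ {k} (h : Fin k → ℕ) v c → weight (insertAt h v c) ≡ c + weight h
weight-insertAt h v c =
  trans (weight-removeAt (insertAt h v c) v)
        (cong₂ _+_ (insertAt-lookup h v c) (weight-cong (insertAt-punchIn h v c)))

record IsRDFAwayFrom {k} (H : Graph k) (v : Fin k) (h : Fin k → ℕ) : Set where
  field
    bounded   : ∀ x → h x ≤ 2
    dominated : ∀ x → v ≢ x → h x ≡ 0 → ∃ λ y → Adj H x y × h y ≡ 2

module _ {k} {H : Graph (suc k)} {v : Fin (suc k)} where

  IsRDF⇒IsRDFAwayFrom : ∀ {h} → IsRDF H h → IsRDFAwayFrom H v h
  IsRDF⇒IsRDFAwayFrom (bounded , dominated) =
    record { bounded = bounded ; dominated = λ x _ → dominated x }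

  IsRDFAwayFrom⇒IsRDF : ∀ {h} → IsRDFAwayFrom H v h →
                        (h v ≡ 0 → ∃ λ y → Adj H v y × h y ≡ 2) → IsRDF H h
  IsRDFAwayFrom⇒IsRDF {h} away rootDominated = bounded , dominated′
    where
    open IsRDFAwayFrom away
    dominated′ : ∀ x → h x ≡ 0 → ∃ λ y → Adj H x y × h y ≡ 2
    dominated′ x with rootView v x
    ... | root     = rootDominated
    ... | other x′ = dominated (punchIn v x′) (Fin.punchInᵢ≢i v x′ ∘ sym)

  insertAt-IsRDFAwayFrom : ∀ {h c} → IsRDF (deleteVertex H v) h → c ≤ 2 →
                           IsRDFAwayFrom H v (insertAt h v c)
  insertAt-IsRDFAwayFrom {h} {c} (bounded , dominated) c≤2 =
    record { bounded = bounded′ ; dominated = dominated′ }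
    where
    bounded′ : ∀ x → insertAt h v c x ≤ 2
    bounded′ x with rootView v x
    ... | root     rewrite insertAt-lookup h v c = c≤2
    ... | other x′ rewrite insertAt-punchIn h v c x′ = bounded x′
    dominated′ : ∀ x → v ≢ x → insertAt h v c x ≡ 0 → ∃ λ y → Adj H x y × insertAt h v c y ≡ 2
    dominated′ x v≢x with rootView v x
    ... | root = ⊥-elim (v≢x refl)
    ... | other x′ rewrite insertAt-punchIn h v c x′ = λ hx′≡0 →
      let (y , x′~y , hy≡2) = dominated x′ hx′≡0
      in  punchIn v y , x′~y , trans (insertAt-punchIn h v c y) hy≡2

  removeAt-IsRDF : ∀ {h} → IsRDFAwayFrom H v h → h v ≡ 0 → IsRDF (deleteVertex H v) (removeAt h v)
  removeAt-IsRDF {h} away hv≡0 = bounded ∘ punchIn v , dominated′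
    where
    open IsRDFAwayFrom away
    dominated′ : ∀ x → h (punchIn v x) ≡ 0 → ∃ λ y → Adj (deleteVertex H v) x y × h (punchIn v y) ≡ 2
    dominated′ x hx≡0 with dominated (punchIn v x) (Fin.punchInᵢ≢i v x ∘ sym) hx≡0
    ... | y , x~y , hy≡2 with rootView v y
    ...   | root     = ⊥-elim (0≢1+n (trans (sym hv≡0) hy≡2))
    ...   | other y′ = y′ , x~y , hy≡2

adj⇒≢ : ∀ {n} (G : Graph n) {x y} → Adj G x y → x ≢ y
adj⇒≢ G {x} x~x refl with trans (sym (irrefl G x)) x~x
... | ()

vertexWithTwoNeighbours : ∀ {n} (G : Graph n) → NoIsolated G → ¬ IsDisjointUnionOfK2 G →
  ∃ λ x → ∃ λ y → ∃ λ z → Adj G x y × Adj G x z × y ≢ z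
vertexWithTwoNeighbours G noIsolated notK₂s
  with Fin.any? (λ x → Fin.any? (λ y → Fin.any? (λ z →
         (adj G x y Bool.≟ true) ×-dec (adj G x z Bool.≟ true) ×-dec ¬? (y Fin.≟ z))))
... | yes found = found
... | no none = ⊥-elim (notK₂s λ x → let (y , x~y) = noIsolated x in y , x~y , unique x y x~y)
  where
  unique : ∀ x y → Adj G x y → ∀ z → Adj G x z → z ≡ y
  unique x y x~y z x~z with z Fin.≟ y
  ... | yes z≡y = z≡y
  ... | no z≢y  = ⊥-elim (none (x , z , y , x~z , x~y , z≢y))

indicator : ∀ {n} → Fin n → Fin n → ℕ
indicator y i with i Fin.≟ y
... | yes _ = 1
... | no _  = 0

indicator-self : ∀ {n} (y : Fin n) → indicator y y ≡ 1
indicator-self y with y Fin.≟ y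
... | yes _  = refl
... | no y≢y = ⊥-elim (y≢y refl)

indicator-other : ∀ {n} {y i : Fin n} → i ≢ y → indicator y i ≡ 0
indicator-other {y = y} {i} i≢y with i Fin.≟ y
... | yes i≡y = ⊥-elim (i≢y i≡y)
... | no _    = refl

weight-indicator : ∀ {n} (y : Fin (suc n)) → weight (indicator y) ≡ 1
weight-indicator {n} y = begin
  weight (indicator y)                               ≡⟨ weight-removeAt (indicator y) y ⟩
  indicator y y + weight (removeAt (indicator y) y)  ≡⟨ cong₂ _+_ (indicator-self y)
                                                          (weight-cong (indicator-other ∘ Fin.punchInᵢ≢i y)) ⟩
  1 + weight {n} (λ _ → 0)                           ≡⟨ cong suc (trans (weight-const n 0) (*-zeroʳ n)) ⟩
  1                                                  ∎
  where open ≡-Reasoning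

module Star {n} (G : Graph (suc n)) {x y z : Fin (suc n)}
            (x~y : Adj G x y) (x~z : Adj G x z) (y≢z : y ≢ z) where

  starValue : ∀ {i} → Dec (i ≡ x) → Dec (i ≡ y) → Dec (i ≡ z) → ℕ
  starValue (yes _) _       _       = 2
  starValue (no _)  (yes _) _       = 0
  starValue (no _)  (no _)  (yes _) = 0
  starValue (no _)  (no _)  (no _)  = 1

  star : Fin (suc n) → ℕ
  star i = starValue (i Fin.≟ x) (i Fin.≟ y) (i Fin.≟ z)

  star-centre : star x ≡ 2
  star-centre with x Fin.≟ x
  ... | yes _  = refl
  ... | no x≢x = ⊥-elim (x≢x refl)

  star-IsRDF : IsRDF G star
  star-IsRDF = (λ i → bounded (i Fin.≟ x) (i Fin.≟ y) (i Fin.≟ z))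
             , (λ i → dominated (i Fin.≟ x) (i Fin.≟ y) (i Fin.≟ z))
    where
    bounded : ∀ {i} dx dy dz → starValue {i} dx dy dz ≤ 2
    bounded (yes _) _       _       = ≤-refl
    bounded (no _)  (yes _) _       = z≤n
    bounded (no _)  (no _)  (yes _) = z≤n
    bounded (no _)  (no _)  (no _)  = s≤s z≤n
    dominated : ∀ {i} dx dy dz → starValue {i} dx dy dz ≡ 0 → ∃ λ j → Adj G i j × star j ≡ 2
    dominated (no _) (yes refl) _          _ = x , trans (Graph.sym G _ x) x~y , star-centre
    dominated (no _) (no _)     (yes refl) _ = x , trans (Graph.sym G _ x) x~z , star-centre

  star-balance : ∀ i → star i + (indicator y i + indicator z i) ≡ 1 + indicator x i
  star-balance i = balance (i Fin.≟ x) (i Fin.≟ y) (i Fin.≟ z)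
    where
    x≢y : x ≢ y
    x≢y = adj⇒≢ G x~y
    x≢z : x ≢ z
    x≢z = adj⇒≢ G x~z
    balance : ∀ dx dy dz → starValue {i} dx dy dz + (indicator y i + indicator z i) ≡ 1 + indicator x i
    balance (yes refl) _ _
      rewrite indicator-other x≢y | indicator-other x≢z | indicator-self i = refl
    balance (no i≢x) (yes refl) _
      rewrite indicator-self i | indicator-other y≢z | indicator-other i≢x = refl
    balance (no i≢x) (no i≢y) (yes refl)
      rewrite indicator-self i | indicator-other i≢y | indicator-other i≢x = refl
    balance (no i≢x) (no i≢y) (no i≢z)
      rewrite indicator-other i≢y | indicator-other i≢z | indicator-other i≢x = refl

  weight-star : weight star + 2 ≡ suc n + 1
  weight-star = begin
    weight star + 2
      ≡⟨ cong (weight star +_) (sym (cong₂ _+_ (weight-indicator y) (weight-indicator z))) ⟩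
    weight star + (weight (indicator y) + weight (indicator z))
      ≡⟨ cong (weight star +_) (sym (weight-distrib-+ (indicator y) (indicator z))) ⟩
    weight star + weight yz
      ≡⟨ sym (weight-distrib-+ star yz) ⟩
    weight (λ i → star i + yz i)
      ≡⟨ weight-cong star-balance ⟩
    weight (λ i → 1 + indicator x i)
      ≡⟨ weight-distrib-+ (λ _ → 1) (indicator x) ⟩
    weight {suc n} (λ _ → 1) + weight (indicator x)
      ≡⟨ cong₂ _+_ (trans (weight-const (suc n) 1) (*-identityʳ (suc n))) (weight-indicator x) ⟩
    suc n + 1
      ∎
    where
    open ≡-Reasoning
    yz : Fin (suc n) → ℕ
    yz i = indicator y i + indicator z i

rdf-lighter-than-order : ∀ {n} (G : Graph n) → NoIsolated G → ¬ IsDisjointUnionOfK2 G →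
                         ∃ λ f → IsRDF G f × weight f < n
rdf-lighter-than-order {zero} G _ notK₂s = ⊥-elim (notK₂s λ ())
rdf-lighter-than-order {suc n} G noIsolated notK₂s
  with vertexWithTwoNeighbours G noIsolated notK₂s
... | x , y , z , x~y , x~z , y≢z =
  star , star-IsRDF ,
  +-cancelʳ-< 1 (weight star) (suc n) (subst (_≤ suc n + 1) (+-suc (weight star) 1) (≤-reflexive weight-star))
  where open Star G x~y x~z y≢z

rdf-below-order-has-two : ∀ {n} (G : Graph n) {f} → IsRDF G f → weight f < n → ∃ λ i → f i ≡ 2
rdf-below-order-has-two {n} G {f} (_ , dominated) light with Fin.any? (λ i → f i ≟ 2)
... | yes two  = two
... | no noTwo = ⊥-elim (<⇒≱ light (subst (_≤ weight f) (trans (weight-const n 1) (*-identityʳ n))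
                                              (weight-mono positive)))
  where
  positive : ∀ i → 1 ≤ f i
  positive i with f i ≟ 0
  ... | no fᵢ≢0  = n≢0⇒n>0 fᵢ≢0
  ... | yes fᵢ≡0 = let (j , _ , fⱼ≡2) = dominated i fᵢ≡0 in ⊥-elim (noTwo (j , fⱼ≡2))

module RootedProduct {n k} (G : Graph n) (H : Graph (suc k)) (v : Fin (suc k)) where

  P : Graph (n * suc k)
  P = rootedProduct G H v

  H-v : Graph k
  H-v = deleteVertex H v

  data CombineView : Fin (n * suc k) → Set where
    ⟨_,_⟩ : ∀ (i : Fin n) (x : Fin (suc k)) → CombineView (combine i x)

  combineView : ∀ a → CombineView a
  combineView a = subst CombineView (Fin.combine-remQuot {n} (suc k) a)
                        ⟨ proj₁ (remQuot {n} (suc k) a) , proj₂ (remQuot {n} (suc k) a) ⟩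

  adj-combine : ∀ i x j y → adj P (combine i x) (combine j y) ≡ rpAdj' G H v (i , x) (j , y)
  adj-combine i x j y = cong₂ (rpAdj' G H v) (Fin.remQuot-combine i x) (Fin.remQuot-combine j y)

  copy-adj : ∀ i {x y} → Adj H x y → Adj P (combine i x) (combine i y)
  copy-adj i {x} {y} x~y rewrite adj-combine i x i y | x~y with i Fin.≟ i
  ... | yes _  = refl
  ... | no i≢i = ⊥-elim (i≢i refl)

  root-adj : ∀ {i j} → Adj G i j → Adj P (combine i v) (combine j v)
  root-adj {i} {j} i~j rewrite adj-combine i v j v | i~j with v Fin.≟ v
  ... | yes _  = ∨-zeroʳ _
  ... | no v≢v = ⊥-elim (v≢v refl)

  adj-cases : ∀ {i x j y} → Adj P (combine i x) (combine j y) →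
              (i ≡ j × Adj H x y) ⊎ (x ≡ v × y ≡ v × Adj G i j)
  adj-cases {i} {x} {j} {y} ix~jy = cases (trans (sym (adj-combine i x j y)) ix~jy)
    where
    cases : rpAdj' G H v (i , x) (j , y) ≡ true → (i ≡ j × Adj H x y) ⊎ (x ≡ v × y ≡ v × Adj G i j)
    cases e with i Fin.≟ j | adj H x y | x Fin.≟ v | y Fin.≟ v
    ... | yes i≡j | true  | _       | _       = inj₁ (i≡j , refl)
    ... | yes _   | false | yes x≡v | yes y≡v = inj₂ (x≡v , y≡v , e)
    ... | no _    | _     | yes x≡v | yes y≡v = inj₂ (x≡v , y≡v , e)
    cases () | yes _ | false | yes _ | no _
    cases () | yes _ | false | no _  | _
    cases () | no _  | _     | yes _ | no _
    cases () | no _  | _     | no _  | _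

  copy : (Fin (n * suc k) → ℕ) → Fin n → Fin (suc k) → ℕ
  copy f i x = f (combine i x)

  weight-copies : ∀ f → weight f ≡ weight (λ i → weight (copy f i))
  weight-copies = weight-combine {n} (suc k)

  module _ {f} (f-RDF : IsRDF P f) where

    copy-dominated : ∀ {i x} → copy f i x ≡ 0 →
      (∃ λ y → Adj H x y × copy f i y ≡ 2) ⊎ (x ≡ v × ∃ λ j → Adj G i j × copy f j v ≡ 2)
    copy-dominated {i} {x} fᵢₓ≡0 with proj₂ f-RDF (combine i x) fᵢₓ≡0
    ... | a , ix~a , fₐ≡2 with combineView a
    ...   | ⟨ j , y ⟩ with adj-cases ix~a
    ...     | inj₁ (refl , x~y)     = inj₁ (y , x~y , fₐ≡2)
    ...     | inj₂ (x≡v , refl , i~j) = inj₂ (x≡v , j , i~j , fₐ≡2)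

    copy-IsRDFAwayFrom : ∀ i → IsRDFAwayFrom H v (copy f i)
    copy-IsRDFAwayFrom i = record { bounded = proj₁ f-RDF ∘ combine i ; dominated = dominated }
      where
      dominated : ∀ x → v ≢ x → copy f i x ≡ 0 → ∃ λ y → Adj H x y × copy f i y ≡ 2
      dominated x v≢x fᵢₓ≡0 with copy-dominated fᵢₓ≡0
      ... | inj₁ internal   = internal
      ... | inj₂ (x≡v , _) = ⊥-elim (v≢x (sym x≡v))

    copy-cases : ∀ i → IsRDF H (copy f i)
                     ⊎ (copy f i v ≡ 0 × IsRDF H-v (removeAt (copy f i) v)
                                       × ∃ λ j → Adj G i j × copy f j v ≡ 2)
    copy-cases i with copy f i v ≟ 0
    ... | no fᵢᵥ≢0 = inj₁ (IsRDFAwayFrom⇒IsRDF (copy-IsRDFAwayFrom i) (⊥-elim ∘ fᵢᵥ≢0))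
    ... | yes fᵢᵥ≡0 with copy-dominated fᵢᵥ≡0
    ...   | inj₁ internal       = inj₁ (IsRDFAwayFrom⇒IsRDF (copy-IsRDFAwayFrom i) (λ _ → internal))
    ...   | inj₂ (_ , external) =
      inj₂ (fᵢᵥ≡0 , removeAt-IsRDF (copy-IsRDFAwayFrom i) fᵢᵥ≡0 , external)

  glue : (Fin n → Fin (suc k) → ℕ) → Fin (n * suc k) → ℕ
  glue h = uncurry h ∘ remQuot {n} (suc k)

  glue-combine : ∀ h i x → glue h (combine i x) ≡ h i x
  glue-combine h i x = cong (uncurry h) (Fin.remQuot-combine i x)

  weight-glue : ∀ h → weight (glue h) ≡ weight (λ i → weight (h i))
  weight-glue h = trans (weight-copies (glue h)) (weight-cong λ i → weight-cong (glue-combine h i))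

  glue-IsRDF : ∀ {f h} → IsRDF G f → (∀ i → h i v ≡ f i) → (∀ i → IsRDFAwayFrom H v (h i)) →
               IsRDF P (glue h)
  glue-IsRDF {f} {h} (_ , f-dominated) roots away = bounded , dominated
    where
    bounded : ∀ a → glue h a ≤ 2
    bounded a = IsRDFAwayFrom.bounded (away _) _
    dominated : ∀ a → glue h a ≡ 0 → ∃ λ b → Adj P a b × glue h b ≡ 2
    dominated a with combineView a
    ... | ⟨ i , x ⟩ rewrite glue-combine h i x with rootView v x
    ...   | root = λ hᵢᵥ≡0 →
      let (j , i~j , fⱼ≡2) = f-dominated i (trans (sym (roots i)) hᵢᵥ≡0)
      in  combine j v , root-adj i~j , trans (glue-combine h j v) (trans (roots j) fⱼ≡2)
    ...   | other x′ = λ hᵢₓ≡0 →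
      let (y , x~y , hᵢy≡2) =
            IsRDFAwayFrom.dominated (away i) (punchIn v x′) (Fin.punchInᵢ≢i v x′ ∘ sym) hᵢₓ≡0
      in  combine i y , copy-adj i x~y , trans (glue-combine h i y) hᵢy≡2

  module _ {f h} (f-RDF : IsRDF G f) (h-RDF : IsRDF H-v h) where

    rdf-upper-bound : ∃ λ F → IsRDF P F × weight F ≡ weight f + n * weight h
    rdf-upper-bound =
        glue extension
      , glue-IsRDF f-RDF (λ i → insertAt-lookup h v (f i))
                         (λ i → insertAt-IsRDFAwayFrom h-RDF (proj₁ f-RDF i))
      , trans (weight-glue extension)
              (trans (weight-cong λ i → weight-insertAt h v (f i)) (weight-+-const f (weight h)))
      where
      extension : Fin n → Fin (suc k) → ℕ
      extension i = insertAt h v (f i)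

    module _ {g} (g-RDF : IsRDF H g) (gᵥ≡2 : g v ≡ 2) (light : weight g ≤ suc (weight h)) where

      patch : ∀ {c} → Dec (c ≡ 2) → Fin (suc k) → ℕ
      patch     (yes _) = g
      patch {c} (no _)  = insertAt h v c

      patch-root : ∀ {c} (d : Dec (c ≡ 2)) → patch d v ≡ c
      patch-root     (yes c≡2) = trans gᵥ≡2 (sym c≡2)
      patch-root {c} (no _)    = insertAt-lookup h v c

      patch-IsRDFAwayFrom : ∀ {c} → c ≤ 2 → (d : Dec (c ≡ 2)) → IsRDFAwayFrom H v (patch d)
      patch-IsRDFAwayFrom c≤2 (yes _) = IsRDF⇒IsRDFAwayFrom g-RDF
      patch-IsRDFAwayFrom c≤2 (no _)  = insertAt-IsRDFAwayFrom h-RDF c≤2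

      weight-patch-≤ : ∀ {c} (d : Dec (c ≡ 2)) → weight (patch d) ≤ c + weight h
      weight-patch-≤     (yes refl) = m≤n⇒m≤1+n light
      weight-patch-≤ {c} (no _)     = ≤-reflexive (weight-insertAt h v c)

      weight-patch-< : ∀ {c} (d : Dec (c ≡ 2)) → c ≡ 2 → weight (patch d) < c + weight h
      weight-patch-< (yes refl) _   = s≤s light
      weight-patch-< (no c≢2)   c≡2 = ⊥-elim (c≢2 c≡2)

      rdf-strict-upper-bound : ∀ {i₀} → f i₀ ≡ 2 →
                               ∃ λ F → IsRDF P F × weight F < weight f + n * weight h
      rdf-strict-upper-bound {i₀} fᵢ₀≡2 =
          glue patched
        , glue-IsRDF f-RDF (λ i → patch-root (f i ≟ 2))
                           (λ i → patch-IsRDFAwayFrom (proj₁ f-RDF i) (f i ≟ 2))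
        , (begin-strict
            weight (glue patched)                   ≡⟨ weight-glue patched ⟩
            weight (λ i → weight (patched i))       <⟨ weight-mono-< (λ i → weight-patch-≤ (f i ≟ 2)) i₀
                                                                     (weight-patch-< (f i₀ ≟ 2) fᵢ₀≡2) ⟩
            weight (λ i → f i + weight h)           ≡⟨ weight-+-const f (weight h) ⟩
            weight f + n * weight h                 ∎)
        where
        open ≤-Reasoning
        patched : Fin n → Fin (suc k) → ℕ
        patched i = patch (f i ≟ 2)

  weight-copy-root≡0 : ∀ f i → copy f i v ≡ 0 → weight (copy f i) ≡ weight (removeAt (copy f i) v)
  weight-copy-root≡0 f i fᵢᵥ≡0 =
    trans (weight-removeAt (copy f i) v) (cong (_+ weight (removeAt (copy f i) v)) fᵢᵥ≡0)

  rdf-lower-bound-uniform : ∀ {γ} → (∀ g → IsRDF H g → γ ≤ weight g) →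
                            (∀ h → IsRDF H-v h → γ ≤ weight h) →
                            ∀ {f} → IsRDF P f → n * γ ≤ weight f
  rdf-lower-bound-uniform {γ} γ≤H γ≤H-v {f} f-RDF =
    subst₂ _≤_ (weight-const n γ) (sym (weight-copies f)) (weight-mono γ≤copy)
    where
    γ≤copy : ∀ i → γ ≤ weight (copy f i)
    γ≤copy i with copy-cases f-RDF i
    ... | inj₁ H-RDF               = γ≤H _ H-RDF
    ... | inj₂ (fᵢᵥ≡0 , H-v-RDF , _) =
      subst (γ ≤_) (sym (weight-copy-root≡0 f i fᵢᵥ≡0)) (γ≤H-v _ H-v-RDF)

  module _ {a} (a≤H-v : ∀ h → IsRDF H-v h → a ≤ weight h)
               (a<H : ∀ g → IsRDF H g → suc a ≤ weight g)
               (a+1<H-at-2 : ∀ g → IsRDF H g → g v ≡ 2 → 2 + a ≤ weight g)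
               {f} (f-RDF : IsRDF P f) where

    record Charge (i : Fin n) : Set where
      field
        value            : ℕ
        value≤2          : value ≤ 2
        root≡2⇒value≡2   : copy f i v ≡ 2 → value ≡ 2
        value≡0⇒external : value ≡ 0 → ∃ λ j → Adj G i j × copy f j v ≡ 2
        copy-weight      : value + a ≤ weight (copy f i)

    charge : ∀ i → Charge i
    charge i with copy-cases f-RDF i
    ... | inj₂ (fᵢᵥ≡0 , H-v-RDF , external) = record
      { value = 0 ; value≤2 = z≤n
      ; root≡2⇒value≡2 = λ fᵢᵥ≡2 → ⊥-elim (0≢1+n (trans (sym fᵢᵥ≡0) fᵢᵥ≡2))
      ; value≡0⇒external = λ _ → external
      ; copy-weight = subst (a ≤_) (sym (weight-copy-root≡0 f i fᵢᵥ≡0)) (a≤H-v _ H-v-RDF) }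
    ... | inj₁ H-RDF with copy f i v ≟ 2
    ...   | yes fᵢᵥ≡2 = record
      { value = 2 ; value≤2 = ≤-refl ; root≡2⇒value≡2 = λ _ → refl ; value≡0⇒external = λ ()
      ; copy-weight = a+1<H-at-2 _ H-RDF fᵢᵥ≡2 }
    ...   | no fᵢᵥ≢2 = record
      { value = 1 ; value≤2 = s≤s z≤n ; root≡2⇒value≡2 = ⊥-elim ∘ fᵢᵥ≢2 ; value≡0⇒external = λ ()
      ; copy-weight = a<H _ H-RDF }

    charges : Fin n → ℕ
    charges i = Charge.value (charge i)

    rdf-lower-bound-charged : IsRDF G charges × weight charges + n * a ≤ weight f
    rdf-lower-bound-charged = (Charge.value≤2 ∘ charge , dominated) , bound
      where
      dominated : ∀ i → charges i ≡ 0 → ∃ λ j → Adj G i j × charges j ≡ 2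
      dominated i cᵢ≡0 =
        let (j , i~j , fⱼᵥ≡2) = Charge.value≡0⇒external (charge i) cᵢ≡0
        in  j , i~j , Charge.root≡2⇒value≡2 (charge j) fⱼᵥ≡2
      bound : weight charges + n * a ≤ weight f
      bound = begin
        weight charges + n * a                ≡⟨ sym (weight-+-const charges a) ⟩
        weight (λ i → charges i + a)          ≤⟨ weight-mono (Charge.copy-weight ∘ charge) ⟩
        weight (λ i → weight (copy f i))      ≡⟨ sym (weight-copies f) ⟩
        weight f                              ∎
        where open ≤-Reasoning

romanDomNum<order : ∀ {n} (G : Graph n) → NoIsolated G → ¬ IsDisjointUnionOfK2 G →
                    ∀ {γ} → IsRomanDomNum G γ → γ < n
romanDomNum<order G noIsolated notK₂s (_ , minimal) =
  let (f , f-RDF , light) = rdf-lighter-than-order G noIsolated notK₂s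
  in  ≤-<-trans (minimal f f-RDF) light

module RomanDominationNumbers {n k} (G : Graph n) (H : Graph (suc k)) (v : Fin (suc k))
  {γGH γG γH γH-v} (γGH-is : IsRomanDomNum (rootedProduct G H v) γGH) (γG-is : IsRomanDomNum G γG)
  (γH-is : IsRomanDomNum H γH) (γH-v-is : IsRomanDomNum (deleteVertex H v) γH-v) where

  open RootedProduct G H v
  private
    fG : Fin n → ℕ
    fG = proj₁ (proj₁ γG-is)
    fG-RDF : IsRDF G fG
    fG-RDF = proj₁ (proj₂ (proj₁ γG-is))
    weight-fG : weight fG ≡ γG
    weight-fG = proj₂ (proj₂ (proj₁ γG-is))
    hH-v : Fin k → ℕ
    hH-v = proj₁ (proj₁ γH-v-is)
    hH-v-RDF : IsRDF (deleteVertex H v) hH-v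
    hH-v-RDF = proj₁ (proj₂ (proj₁ γH-v-is))
    weight-hH-v : weight hH-v ≡ γH-v
    weight-hH-v = proj₂ (proj₂ (proj₁ γH-v-is))

  γH≤1+γH-v : γH ≤ suc γH-v
  γH≤1+γH-v = subst (γH ≤_) (trans (weight-insertAt hH-v v 1) (cong suc weight-hH-v))
                    (proj₂ γH-is (insertAt hH-v v 1) (IsRDFAwayFrom⇒IsRDF root-extension root≢0))
    where
    root-extension : IsRDFAwayFrom H v (insertAt hH-v v 1)
    root-extension = insertAt-IsRDFAwayFrom {H = H} {v = v} hH-v-RDF (s≤s z≤n)
    root≢0 : insertAt hH-v v 1 v ≡ 0 → ∃ λ y → Adj H v y × insertAt hH-v v 1 y ≡ 2
    root≢0 e = ⊥-elim (1+n≢0 (trans (sym (insertAt-lookup hH-v v 1)) e))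

  a : ℕ
  a = γH ∸ 1

  1+a≡γH : suc a ≡ γH
  1+a≡γH = let (g , g-RDF , weight-g) = proj₁ γH-is
           in  trans (+-comm 1 a) (m∸n+n≡m (subst (1 ≤_) weight-g (rdf-weight-positive H g-RDF)))

  a≤γH-v : a ≤ γH-v
  a≤γH-v = ∸-monoˡ-≤ 1 γH≤1+γH-v

  γGH≤γG+n*γH-v : γGH ≤ γG + n * γH-v
  γGH≤γG+n*γH-v = let (F , F-RDF , weight-F) = rdf-upper-bound fG-RDF hH-v-RDF
                  in  subst (γGH ≤_) (trans weight-F (cong₂ (λ w c → w + n * c) weight-fG weight-hH-v))
                            (proj₂ γGH-is F F-RDF)

  γH≤γH-v⇒n*γH≤γGH : γH ≤ γH-v → n * γH ≤ γGH
  γH≤γH-v⇒n*γH≤γGH γH≤γH-v =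
    let (F , F-RDF , weight-F) = proj₁ γGH-is
    in  subst (n * γH ≤_) weight-F
              (rdf-lower-bound-uniform (proj₂ γH-is)
                                       (λ h h-RDF → ≤-trans γH≤γH-v (proj₂ γH-v-is h h-RDF)) F-RDF)

  OptimalRootsAtMost1 : Set
  OptimalRootsAtMost1 = ∀ g → IsRDF H g → weight g ≡ γH → g v ≤ 1

  γG+n*a≤γGH : OptimalRootsAtMost1 → γG + n * a ≤ γGH
  γG+n*a≤γGH optimal⇒root≤1 =
    let (F , F-RDF , weight-F) = proj₁ γGH-is
        (c-RDF , bound) = rdf-lower-bound-charged a≤H-v a<H a+1<H-at-2 F-RDF
    in  subst (γG + n * a ≤_) weight-F (≤-trans (+-monoˡ-≤ (n * a) (proj₂ γG-is _ c-RDF)) bound)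
    where
    a≤H-v : ∀ h → IsRDF (deleteVertex H v) h → a ≤ weight h
    a≤H-v h h-RDF = ≤-trans a≤γH-v (proj₂ γH-v-is h h-RDF)
    a<H : ∀ g → IsRDF H g → suc a ≤ weight g
    a<H g g-RDF = subst (_≤ weight g) (sym 1+a≡γH) (proj₂ γH-is g g-RDF)
    a+1<H-at-2 : ∀ g → IsRDF H g → g v ≡ 2 → 2 + a ≤ weight g
    a+1<H-at-2 g g-RDF gᵥ≡2 = ≤∧≢⇒< (a<H g g-RDF) λ 1+a≡weight →
      <⇒≱ (subst (1 <_) (sym gᵥ≡2) ≤-refl) (optimal⇒root≤1 g g-RDF (trans (sym 1+a≡weight) 1+a≡γH))

  γGH<γG+n*γH-v : γG < n → suc γH-v ≡ γH → ∀ g → IsRDF H g → weight g ≡ γH → g v ≡ 2 →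
                  γGH < γG + n * γH-v
  γGH<γG+n*γH-v γG<n 1+γH-v≡γH g g-RDF weight-g gᵥ≡2 =
    let (i₀ , fGᵢ₀≡2) = rdf-below-order-has-two G fG-RDF (subst (_< n) (sym weight-fG) γG<n)
        light = ≤-reflexive (trans weight-g (trans (sym 1+γH-v≡γH) (cong suc (sym weight-hH-v))))
        (F , F-RDF , weight-F) = rdf-strict-upper-bound fG-RDF hH-v-RDF g-RDF gᵥ≡2 light fGᵢ₀≡2
    in  ≤-<-trans (proj₂ γGH-is F F-RDF)
                  (subst (weight F <_) (cong₂ (λ w c → w + n * c) weight-fG weight-hH-v) weight-F)

  module _ (γG<n : γG < n) (γGH≡γG+n*a : γGH ≡ γG + n * a) where

    γH-v≡a : γH-v ≡ a
    γH-v≡a with γH-v ≤? a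
    ... | yes γH-v≤a = ≤-antisym γH-v≤a a≤γH-v
    ... | no γH-v≰a  =
      ⊥-elim (<⇒≱ γGH<n*γH (γH≤γH-v⇒n*γH≤γGH (subst (_≤ γH-v) 1+a≡γH (≰⇒> γH-v≰a))))
      where
      γGH<n*γH : γGH < n * γH
      γGH<n*γH = begin-strict
        γGH           ≡⟨ γGH≡γG+n*a ⟩
        γG + n * a    <⟨ +-monoˡ-< (n * a) γG<n ⟩
        n + n * a     ≡⟨ sym (*-suc n a) ⟩
        n * suc a     ≡⟨ cong (n *_) 1+a≡γH ⟩
        n * γH        ∎
        where open ≤-Reasoning

    optimalRootsAtMost1 : OptimalRootsAtMost1
    optimalRootsAtMost1 g g-RDF weight-g with g v ≤? 1
    ... | yes gᵥ≤1 = gᵥ≤1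
    ... | no gᵥ≰1  = ⊥-elim (<-irrefl (trans γGH≡γG+n*a (cong (λ c → γG + n * c) (sym γH-v≡a)))
                       (γGH<γG+n*γH-v γG<n (trans (cong suc γH-v≡a) 1+a≡γH) g g-RDF weight-g
                                      (≤-antisym (proj₁ g-RDF v) (≰⇒> gᵥ≰1))))

  γGH≡γG+n*a : γH-v ≡ a → OptimalRootsAtMost1 → γGH ≡ γG + n * a
  γGH≡γG+n*a γH-v≡a optimal⇒root≤1 =
    ≤-antisym (subst (λ c → γGH ≤ γG + n * c) γH-v≡a γGH≤γG+n*γH-v)
              (γG+n*a≤γGH optimal⇒root≤1)

theorem3p7 : ∀ {n m} (G : Graph n) (H : Graph (suc (suc m))) (v : Fin (suc (suc m))) →
    NoIsolated G → ¬ IsDisjointUnionOfK2 G →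
    ∀ (γGH γG γH γHv : ℕ) →
    IsRomanDomNum (rootedProduct G H v) γGH → IsRomanDomNum G γG →
    IsRomanDomNum H γH → IsRomanDomNum (deleteVertex H v) γHv →
    (γGH ≡ γG + n * (γH ∸ 1))
      ⇔ ((γHv ≡ γH ∸ 1) × (∀ g → IsRDF H g → weight g ≡ γH → g v ≤ 1))
theorem3p7 {n} G H v noIsolated notK₂s _ γG _ _ γGH-is γG-is γH-is γHv-is =
  mk⇔ (λ γGH≡ → γH-v≡a γG<n γGH≡ , optimalRootsAtMost1 γG<n γGH≡) (uncurry γGH≡γG+n*a)
  where
  open RomanDominationNumbers G H v γGH-is γG-is γH-is γHv-is
  γG<n : γG < n
  γG<n = romanDomNum<order G noIsolated notK₂s γG-is
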